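{- Let $G$, $\mathrm{sh}_0$, $\mathrm{sh}_1$ be as in the context. Define on $G$ two binary operations by $g*h:=g\cdot\mathrm{sh}_1(h)\cdot\Sigma_\varepsilon\cdot\mathrm{sh}_1(g)^{ -1}$ and $g\circ h:=g\cdot\mathrm{sh}_1(h)\cdot A_\varepsilon$. Let $H=\mathrm{sh}_0(G)$ and let $M$ be the set of cosets $gH$, $g\in G$. Then the operations $gH*hH:=(g*h)H$ and $gH\circ hH:=(g\circ h)H$ are well defined on $M$, and $(M,*,\circ)$ satisfies the three laws $x*(y*z)=(x*y)*(x*z)$, $x*(y\circ z)=(x*y)\circ(x*z)$, $x*(y*z)=(x\circ y)*z$ for all $x,y,z\in M$.
   Context: Addresses are finite words over $\{0,1\}$, $\varepsilon$ the empty address; $\alpha,\beta$ are incomparable if there is $\gamma$ with $\gamma0$ a prefix of $\alpha$ and $\gamma1$ a prefix of $\beta$, or vice versa. $G$ is the group generated by elements $\Sigma_\alpha, A_\alpha$ ($\alpha\in\{0,1\}^*$) subject to the following relations, where $X,Y$ range over $\{\Sigma,A\}$ and $\alpha,\delta$ over all addresses: (1) $X_\alpha Y_\beta=Y_\beta X_\alpha$ for $\alpha,\beta$ incomparable; (2) $X_{\alpha0\delta}\Sigma_\alpha=\Sigma_\alpha X_{\alpha00\delta}X_{\alpha10\delta}$; (3) $X_{\alpha10\delta}\Sigma_\alpha=\Sigma_\alpha X_{\alpha01\delta}$; (4) $X_{\alpha11\delta}\Sigma_\alpha=\Sigma_\alpha X_{\alpha11\delta}$; (5) $X_{\alpha0\delta}A_\alpha=A_\alpha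 X_{\alpha00\delta}$; (6) $X_{\alpha10\delta}A_\alpha=A_\alpha X_{\alpha01\delta}$; (7) $X_{\alpha11\delta}A_\alpha=A_\alpha X_{\alpha1\delta}$; (8) $\Sigma_\alpha\Sigma_{\alpha1}\Sigma_\alpha=\Sigma_{\alpha1}\Sigma_\alpha\Sigma_{\alpha1}\Sigma_{\alpha0}$; (9) $\Sigma_\alpha\Sigma_{\alpha1}A_\alpha=A_{\alpha1}\Sigma_\alpha\Sigma_{\alpha0}$; (10) $A_\alpha\Sigma_\alpha=\Sigma_{\alpha1}\Sigma_\alpha A_{\alpha1}A_{\alpha0}$. For an address $\gamma$, $\mathrm{sh}_\gamma$ is the endomorphism of $G$ with $\Sigma_\alpha\mapsto\Sigma_{\gamma\alpha}$, $A_\alpha\mapsto A_{\gamma\alpha}$. -}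

module Defs where

open import Data.Bool using (Bool; true; false; not)
open import Data.List using (List; []; _∷_; _++_; reverse; map)
open import Data.Product using (Σ; _×_; _,_)
open import Data.Sum using (_⊎_)
open import Relation.Binary.PropositionalEquality using (_≡_)

-- Addresses: finite words over {0,1}; 0 = false, 1 = true.
Addr : Set
Addr = List Bool

ε : Addr
ε = []

infixr 5 _·0_ _·1_
_·0_ : Addr → Addr → Addr
α ·0 δ = α ++ (false ∷ δ)
_·1_ : Addr → Addr → Addr
α ·1 δ = α ++ (true ∷ δ)

Incomparable : Addr → Addr → Set
Incomparable α β =
  Σ Addr (λ γ → Σ Addr (λ δ₁ → Σ Addr (λ δ₂ →
    (α ≡ γ ·0 δ₁ × β ≡ γ ·1 δ₂) ⊎ (α ≡ γ ·1 δ₁ × β ≡ γ ·0 δ₂))))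

data Kind : Set where
  kΣ kA : Kind

-- A letter: a generator X_α with a sign (true = X_α, false = X_α⁻¹).
record Letter : Set where
  constructor lt
  field
    kind : Kind
    addr : Addr
    pos  : Bool

-- Words in the generators and their inverses (elements of the free group, unreduced).
Word : Set
Word = List Letter

gen : Kind → Addr → Word
gen k α = lt k α true ∷ []

S : Addr → Word
S = gen kΣ
A : Addr → Word
A = gen kA

invL : Letter → Letter
invL (lt k α b) = lt k α (not b)

infixr 6 _⊙_
_⊙_ : Word → Word → Word
_⊙_ = _++_

one : Word
one = []

inv : Word → Word
inv w = reverse (map invL w)

data Rel : Word → Word → Set where
  r1  : ∀ X Y α β → Incomparable α β → Rel (gen X α ⊙ gen Y β) (gen Y β ⊙ gen X α)
  r2  : ∀ X α δ → Rel (gen X (α ·0 δ) ⊙ S α)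
                      (S α ⊙ gen X (α ++ false ∷ false ∷ δ) ⊙ gen X (α ++ true ∷ false ∷ δ))
  r3  : ∀ X α δ → Rel (gen X (α ++ true ∷ false ∷ δ) ⊙ S α) (S α ⊙ gen X (α ++ false ∷ true ∷ δ))
  r4  : ∀ X α δ → Rel (gen X (α ++ true ∷ true ∷ δ) ⊙ S α) (S α ⊙ gen X (α ++ true ∷ true ∷ δ))
  r5  : ∀ X α δ → Rel (gen X (α ·0 δ) ⊙ A α) (A α ⊙ gen X (α ++ false ∷ false ∷ δ))
  r6  : ∀ X α δ → Rel (gen X (α ++ true ∷ false ∷ δ) ⊙ A α) (A α ⊙ gen X (α ++ false ∷ true ∷ δ))
  r7  : ∀ X α δ → Rel (gen X (α ++ true ∷ true ∷ δ) ⊙ A α) (A α ⊙ gen X (α ·1 δ))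
  r8  : ∀ α → Rel (S α ⊙ S (α ·1 []) ⊙ S α)
                  (S (α ·1 []) ⊙ S α ⊙ S (α ·1 []) ⊙ S (α ·0 []))
  r9  : ∀ α → Rel (S α ⊙ S (α ·1 []) ⊙ A α) (A (α ·1 []) ⊙ S α ⊙ S (α ·0 []))
  r10 : ∀ α → Rel (A α ⊙ S α) (S (α ·1 []) ⊙ S α ⊙ A (α ·1 []) ⊙ A (α ·0 []))

infix 4 _≈_
data _≈_ : Word → Word → Set where
  ≈-refl   : ∀ {u} → u ≈ u
  ≈-sym    : ∀ {u v} → u ≈ v → v ≈ u
  ≈-trans  : ∀ {u v w} → u ≈ v → v ≈ w → u ≈ w
  ≈-cong   : ∀ {u u' v v'} → u ≈ u' → v ≈ v' → u ⊙ v ≈ u' ⊙ v'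
  ≈-cancel : ∀ l → (l ∷ invL l ∷ []) ≈ one
  ≈-rel    : ∀ {u v} → Rel u v → u ≈ v

sh : Addr → Word → Word
sh γ = map (λ { (lt k α b) → lt k (γ ++ α) b })

sh0 sh1 : Word → Word
sh0 = sh (false ∷ [])
sh1 = sh (true ∷ [])

_✶_ : Word → Word → Word
g ✶ h = g ⊙ sh1 h ⊙ S ε ⊙ inv (sh1 g)

_⊚_ : Word → Word → Word
g ⊚ h = g ⊙ sh1 h ⊙ A ε

InH : Word → Set
InH w = Σ Word (λ h → w ≈ sh0 h)

-- Equality of left cosets: gH = g'H iff g⁻¹g' ∈ H.
infix 4 _~_
_~_ : Word → Word → Set
g ~ g' = InH (inv g ⊙ g')

-- Relation (1) makes sh₀(G) and sh₁(G) commute, and relations (2)-(7), pushed from the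
-- generators to arbitrary words, say how Σ_ε and A_ε conjugate sh₀(G), sh₁₀(G) and sh₁₁(G).
-- Consequently, replacing g, h by g·sh₀(a), h·sh₀(b) changes g * h and g ∘ h only by the right
-- factor sh₀(sh₀(a)·sh₁(b)) ∈ H.  The three laws already hold in G up to a right factor in H:
-- Σ₀ for the first two, coming from relations (8) and (9), and A₀ for the third, from (10).

module Submission where

open import Data.Bool using (true; false)
open import Data.List using (List; []; _∷_; _++_; _∷ʳ_; map; reverse; concat)
open import Data.List.Properties
  using (++-assoc; ++-identityʳ; map-++; map-∘; map-cong; map-id; reverse-++; reverse-map;
         reverse-involutive; unfold-reverse; concat-++)
open import Data.Nat using (ℕ; zero; suc)
open import Data.Product using (_×_; _,_; proj₁)
open import Data.Sum using (inj₁; inj₂)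
open import Data.Unit using (⊤)
open import Function using (_∘_)
open import Relation.Binary.Bundles using (Setoid)
open import Relation.Binary.PropositionalEquality
  using (_≡_; refl; sym; trans; cong; cong₂; subst; module ≡-Reasoning)
open import Defs

≡⇒≈ : ∀ {u v} → u ≡ v → u ≈ v
≡⇒≈ refl = ≈-refl

invL-involutive : ∀ l → invL (invL l) ≡ l
invL-involutive (lt k α true)  = refl
invL-involutive (lt k α false) = refl

inv-⊙ : ∀ u v → inv (u ⊙ v) ≡ inv v ⊙ inv u
inv-⊙ u v = trans (cong reverse (map-++ invL u v)) (reverse-++ (map invL u) (map invL v))

inv-involutive : ∀ w → inv (inv w) ≡ w
inv-involutive w = begin
  reverse (map invL (reverse (map invL w))) ≡⟨ cong reverse (reverse-map invL (map invL w)) ⟩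
  reverse (reverse (map invL (map invL w))) ≡⟨ reverse-involutive _ ⟩
  map invL (map invL w)                     ≡⟨ sym (map-∘ w) ⟩
  map (invL ∘ invL) w                       ≡⟨ map-cong invL-involutive w ⟩
  map (λ l → l) w                           ≡⟨ map-id w ⟩
  w                                         ∎
  where open ≡-Reasoning

invs : List Word → List Word
invs ws = reverse (map inv ws)

inv-concat : ∀ ws → inv (concat ws) ≡ concat (invs ws)
inv-concat []       = refl
inv-concat (w ∷ ws) = begin
  inv (w ⊙ concat ws)                                  ≡⟨ inv-⊙ w (concat ws) ⟩
  inv (concat ws) ⊙ inv w                              ≡⟨ cong₂ _++_ (inv-concat ws) (sym (++-identityʳ (inv w))) ⟩
  concat (reverse (map inv ws)) ⊙ concat (inv w ∷ [])  ≡⟨ concat-++ (reverse (map inv ws)) (inv w ∷ []) ⟩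
  concat (reverse (map inv ws) ∷ʳ inv w)               ≡⟨ cong concat (sym (unfold-reverse (inv w) (map inv ws))) ⟩
  concat (invs (w ∷ ws))                               ∎
  where open ≡-Reasoning

-- No trailing `one`, so that ∏ (u ∷ v ∷ []) is u ⊙ v on the nose; in particular g ✶ h and
-- g ⊚ h are by definition the products of their four, resp. three, factors.
∏ : List Word → Word
∏ []           = one
∏ (w ∷ [])     = w
∏ (w ∷ v ∷ ws) = w ⊙ ∏ (v ∷ ws)

∏≡concat : ∀ ws → ∏ ws ≡ concat ws
∏≡concat []           = refl
∏≡concat (w ∷ [])     = sym (++-identityʳ w)
∏≡concat (w ∷ v ∷ ws) = cong (w ⊙_) (∏≡concat (v ∷ ws))

∏-++ : ∀ us vs → ∏ (us ++ vs) ≡ ∏ us ⊙ ∏ vs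
∏-++ us vs = begin
  ∏ (us ++ vs)              ≡⟨ ∏≡concat (us ++ vs) ⟩
  concat (us ++ vs)         ≡⟨ sym (concat-++ us vs) ⟩
  concat us ⊙ concat vs     ≡⟨ sym (cong₂ _++_ (∏≡concat us) (∏≡concat vs)) ⟩
  ∏ us ⊙ ∏ vs               ∎
  where open ≡-Reasoning

inv-∏ : ∀ ws → inv (∏ ws) ≡ ∏ (invs ws)
inv-∏ ws = begin
  inv (∏ ws)           ≡⟨ cong inv (∏≡concat ws) ⟩
  inv (concat ws)      ≡⟨ inv-concat ws ⟩
  concat (invs ws)     ≡⟨ sym (∏≡concat (invs ws)) ⟩
  ∏ (invs ws)          ∎
  where open ≡-Reasoning

infix 4 _≋_
record _≋_ (us vs : List Word) : Set where
  constructor from-≈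
  field to-≈ : ∏ us ≈ ∏ vs
open _≋_ public

≋-reflexive : ∀ {us vs} → ∏ us ≡ ∏ vs → us ≋ vs
≋-reflexive e = from-≈ (≡⇒≈ e)

≋-refl : ∀ {us} → us ≋ us
≋-refl = from-≈ ≈-refl

≋-sym : ∀ {us vs} → us ≋ vs → vs ≋ us
≋-sym (from-≈ e) = from-≈ (≈-sym e)

≋-trans : ∀ {us vs ws} → us ≋ vs → vs ≋ ws → us ≋ ws
≋-trans (from-≈ e) (from-≈ f) = from-≈ (≈-trans e f)

≋-setoid : Setoid _ _
≋-setoid = record
  { Carrier       = List Word
  ; _≈_           = _≋_
  ; isEquivalence = record { refl = ≋-refl ; sym = ≋-sym ; trans = ≋-trans }
  }

≈⇒≋ : ∀ {u v} → u ≈ v → (u ∷ []) ≋ (v ∷ [])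
≈⇒≋ = from-≈

≡⇒≋ : ∀ {u v} → u ≡ v → (u ∷ []) ≋ (v ∷ [])
≡⇒≋ e = from-≈ (≡⇒≈ e)

flatten : ∀ ws → (∏ ws ∷ []) ≋ ws
flatten ws = from-≈ ≈-refl

≋-++ : ∀ {us us' vs vs'} → us ≋ us' → vs ≋ vs' → (us ++ vs) ≋ (us' ++ vs')
≋-++ {us} {us'} {vs} {vs'} (from-≈ e) (from-≈ f) =
  from-≈ (≈-trans (≡⇒≈ (∏-++ us vs)) (≈-trans (≈-cong e f) (≡⇒≈ (sym (∏-++ us' vs')))))

Factors : ℕ → Set
Factors zero    = ⊤
Factors (suc n) = Word × Factors n

listed : ∀ n → Factors n → List Word
listed zero    _        = []
listed (suc n) (w , ws) = w ∷ listed n ws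

-- Factors n is a record type, so Agda eta-expands the prefix and reads it, together with the
-- suffix, off the list being rewritten: only the number n of skipped factors is given.
at : ∀ n {pre : Factors n} {us vs post} →
     us ≋ vs → (listed n pre ++ us ++ post) ≋ (listed n pre ++ vs ++ post)
at n {pre} {post = post} p = ≋-++ (≋-refl {listed n pre}) (≋-++ p (≋-refl {post}))

open import Relation.Binary.Reasoning.Setoid ≋-setoid

cancelʳ : ∀ w → (w ∷ inv w ∷ []) ≋ []
cancelʳ []      = ≋-reflexive refl
cancelʳ (l ∷ w) = begin
  (l ∷ w) ∷ inv (l ∷ w) ∷ []
    ≈⟨ ≋-reflexive (cong ((l ∷ w) ⊙_) (inv-⊙ (l ∷ []) w)) ⟩
  (l ∷ []) ∷ w ∷ inv w ∷ (invL l ∷ []) ∷ []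
    ≈⟨ at 1 (cancelʳ w) ⟩
  (l ∷ []) ∷ (invL l ∷ []) ∷ []
    ≈⟨ from-≈ (≈-cancel l) ⟩
  []
    ∎

cancelˡ : ∀ w → (inv w ∷ w ∷ []) ≋ []
cancelˡ w = subst (λ v → (inv w ∷ v ∷ []) ≋ []) (inv-involutive w) (cancelʳ (inv w))

inv-cong : ∀ {u v} → u ≈ v → inv u ≈ inv v
inv-cong {u} {v} u≈v = to-≈ (begin
  inv u ∷ []              ≈⟨ ≋-sym (at 1 (cancelʳ v)) ⟩
  inv u ∷ v ∷ inv v ∷ []  ≈⟨ at 1 (≈⇒≋ (≈-sym u≈v)) ⟩
  inv u ∷ u ∷ inv v ∷ []  ≈⟨ at 0 (cancelˡ u) ⟩
  inv v ∷ []              ∎)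

≋-inv : ∀ {us vs} → us ≋ vs → invs us ≋ invs vs
≋-inv {us} {vs} (from-≈ e) =
  from-≈ (≈-trans (≡⇒≈ (sym (inv-∏ us))) (≈-trans (inv-cong e) (≡⇒≈ (inv-∏ vs))))

conj-inv : ∀ {u c v} → (u ∷ c ∷ []) ≋ (c ∷ v ∷ []) → (inv u ∷ c ∷ []) ≋ (c ∷ inv v ∷ [])
conj-inv {u} {c} {v} uc≋cv = begin
  inv u ∷ c ∷ []               ≈⟨ ≋-sym (at 2 (cancelʳ v)) ⟩
  inv u ∷ c ∷ v ∷ inv v ∷ []   ≈⟨ at 1 (≋-sym uc≋cv) ⟩
  inv u ∷ u ∷ c ∷ inv v ∷ []   ≈⟨ at 0 (cancelˡ u) ⟩
  c ∷ inv v ∷ []               ∎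

sh-∏ : ∀ γ ws → (sh γ (∏ ws) ∷ []) ≋ map (sh γ) ws
sh-∏ γ ws = ≋-reflexive (sh-∏≡ ws)
  where
  sh-∏≡ : ∀ ws → sh γ (∏ ws) ≡ ∏ (map (sh γ) ws)
  sh-∏≡ []           = refl
  sh-∏≡ (w ∷ [])     = refl
  sh-∏≡ (w ∷ v ∷ ws) = trans (map-++ _ w (∏ (v ∷ ws))) (cong (sh γ w ⊙_) (sh-∏≡ (v ∷ ws)))

sh-inv : ∀ γ w → sh γ (inv w) ≡ inv (sh γ w)
sh-inv γ w = trans (reverse-map _ (map invL w)) (cong reverse (trans (sym (map-∘ w)) (map-∘ w)))

sh-sh : ∀ γ δ w → sh γ (sh δ w) ≡ sh (γ ++ δ) w
sh-sh γ δ w =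
  trans (sym (map-∘ w)) (map-cong (λ { (lt k α b) → cong (λ β → lt k β b) (sym (++-assoc γ δ α)) }) w)

sh-incomparable : ∀ γ {α β} → Incomparable α β → Incomparable (γ ++ α) (γ ++ β)
sh-incomparable γ (δ , δ₁ , δ₂ , inj₁ (refl , refl)) =
  γ ++ δ , δ₁ , δ₂ , inj₁ (sym (++-assoc γ δ _) , sym (++-assoc γ δ _))
sh-incomparable γ (δ , δ₁ , δ₂ , inj₂ (refl , refl)) =
  γ ++ δ , δ₁ , δ₂ , inj₂ (sym (++-assoc γ δ _) , sym (++-assoc γ δ _))

sh-Rel : ∀ γ {u v} → Rel u v → Rel (sh γ u) (sh γ v)
sh-Rel γ (r1 X Y α β α⊥β) = r1 X Y (γ ++ α) (γ ++ β) (sh-incomparable γ α⊥β)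
sh-Rel γ (r2 X α δ)
  rewrite sym (++-assoc γ α (false ∷ δ)) | sym (++-assoc γ α (false ∷ false ∷ δ))
        | sym (++-assoc γ α (true ∷ false ∷ δ)) = r2 X (γ ++ α) δ
sh-Rel γ (r3 X α δ)
  rewrite sym (++-assoc γ α (true ∷ false ∷ δ)) | sym (++-assoc γ α (false ∷ true ∷ δ)) = r3 X (γ ++ α) δ
sh-Rel γ (r4 X α δ)
  rewrite sym (++-assoc γ α (true ∷ true ∷ δ)) = r4 X (γ ++ α) δ
sh-Rel γ (r5 X α δ)
  rewrite sym (++-assoc γ α (false ∷ δ)) | sym (++-assoc γ α (false ∷ false ∷ δ)) = r5 X (γ ++ α) δ
sh-Rel γ (r6 X α δ)
  rewrite sym (++-assoc γ α (true ∷ false ∷ δ)) | sym (++-assoc γ α (false ∷ true ∷ δ)) = r6 X (γ ++ α) δ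
sh-Rel γ (r7 X α δ)
  rewrite sym (++-assoc γ α (true ∷ true ∷ δ)) | sym (++-assoc γ α (true ∷ δ)) = r7 X (γ ++ α) δ
sh-Rel γ (r8 α)
  rewrite sym (++-assoc γ α (true ∷ [])) | sym (++-assoc γ α (false ∷ [])) = r8 (γ ++ α)
sh-Rel γ (r9 α)
  rewrite sym (++-assoc γ α (true ∷ [])) | sym (++-assoc γ α (false ∷ [])) = r9 (γ ++ α)
sh-Rel γ (r10 α)
  rewrite sym (++-assoc γ α (true ∷ [])) | sym (++-assoc γ α (false ∷ [])) = r10 (γ ++ α)

sh-cong : ∀ γ {u v} → u ≈ v → sh γ u ≈ sh γ v
sh-cong γ ≈-refl                = ≈-refl
sh-cong γ (≈-sym e)             = ≈-sym (sh-cong γ e)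
sh-cong γ (≈-trans e f)         = ≈-trans (sh-cong γ e) (sh-cong γ f)
sh-cong γ (≈-cong {u} {u'} {v} {v'} e f) =
  to-≈ (≋-trans (sh-∏ γ (u ∷ v ∷ [])) (≋-trans (≋-++ (≈⇒≋ (sh-cong γ e)) (≈⇒≋ (sh-cong γ f)))
                                               (≋-sym (sh-∏ γ (u' ∷ v' ∷ [])))))
sh-cong γ (≈-cancel (lt k α b)) = ≈-cancel (lt k (γ ++ α) b)
sh-cong γ (≈-rel r)             = ≈-rel (sh-Rel γ r)

image : (Kind → Addr → Word) → Letter → Word
image φ (lt k α true)  = φ k α
image φ (lt k α false) = inv (φ k α)

extend : (Kind → Addr → Word) → Word → Word
extend φ []      = one
extend φ (l ∷ w) = image φ l ⊙ extend φ w

extend-gen : ∀ δ w → extend (λ k α → gen k (δ ++ α)) w ≡ sh δ w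
extend-gen δ []                 = refl
extend-gen δ (lt k α true ∷ w)  = cong (lt k (δ ++ α) true ∷_) (extend-gen δ w)
extend-gen δ (lt k α false ∷ w) = cong (lt k (δ ++ α) false ∷_) (extend-gen δ w)

conj-extend : ∀ γ c φ → (∀ k α → (gen k (γ ++ α) ∷ c ∷ []) ≋ (c ∷ φ k α ∷ [])) →
              ∀ w → (sh γ w ∷ c ∷ []) ≋ (c ∷ extend φ w ∷ [])
conj-extend γ c φ conj-gen []      = ≋-reflexive (sym (++-identityʳ c))
conj-extend γ c φ conj-gen (l ∷ w) = begin
  sh γ (l ∷ w) ∷ c ∷ []                ≈⟨ ≋-reflexive refl ⟩
  sh γ (l ∷ []) ∷ sh γ w ∷ c ∷ []      ≈⟨ at 1 (conj-extend γ c φ conj-gen w) ⟩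
  sh γ (l ∷ []) ∷ c ∷ extend φ w ∷ []  ≈⟨ at 0 (conj-letter l) ⟩
  c ∷ image φ l ∷ extend φ w ∷ []      ≈⟨ ≋-reflexive refl ⟩
  c ∷ extend φ (l ∷ w) ∷ []            ∎
  where
  conj-letter : ∀ l → (sh γ (l ∷ []) ∷ c ∷ []) ≋ (c ∷ image φ l ∷ [])
  conj-letter (lt k α true)  = conj-gen k α
  conj-letter (lt k α false) = conj-inv (conj-gen k α)

conj-sh : ∀ γ δ c → (∀ k α → (gen k (γ ++ α) ∷ c ∷ []) ≋ (c ∷ gen k (δ ++ α) ∷ [])) →
          ∀ w → (sh γ w ∷ c ∷ []) ≋ (c ∷ sh δ w ∷ [])
conj-sh γ δ c conj-gen w =
  ≋-trans (conj-extend γ c _ conj-gen w) (≋-reflexive (cong (c ⊙_) (extend-gen δ w)))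

sh0-sh1-comm : ∀ u v → (sh0 u ∷ sh1 v ∷ []) ≋ (sh1 v ∷ sh0 u ∷ [])
sh0-sh1-comm u v = conj-sh (false ∷ []) (false ∷ []) (sh1 v) (λ k α → ≋-sym (sh1-comm k α)) u
  where
  sh1-comm : ∀ k α → (sh1 v ∷ gen k (false ∷ α) ∷ []) ≋ (gen k (false ∷ α) ∷ sh1 v ∷ [])
  sh1-comm k α = conj-sh (true ∷ []) (true ∷ []) (gen k (false ∷ α))
    (λ k' β → from-≈ (≈-rel (r1 k' k (true ∷ β) (false ∷ α) (ε , β , α , inj₂ (refl , refl))))) v

sh0-inv-sh1-comm : ∀ u vs → (sh0 u ∷ map (inv ∘ sh1) vs) ≋ (map (inv ∘ sh1) vs ∷ʳ sh0 u)
sh0-inv-sh1-comm u []       = ≋-refl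
sh0-inv-sh1-comm u (v ∷ vs) = begin
  sh0 u ∷ inv (sh1 v) ∷ map (inv ∘ sh1) vs
    ≈⟨ at 0 (≋-sym (conj-inv (≋-sym (sh0-sh1-comm u v)))) ⟩
  inv (sh1 v) ∷ sh0 u ∷ map (inv ∘ sh1) vs
    ≈⟨ ≋-++ (≋-refl {inv (sh1 v) ∷ []}) (sh0-inv-sh1-comm u vs) ⟩
  inv (sh1 v) ∷ (map (inv ∘ sh1) vs ∷ʳ sh0 u)
    ∎

Σε Σ₀ Σ₁ Aε A₀ A₁ : Word
Σε = S ε
Σ₀ = S (false ∷ [])
Σ₁ = S (true ∷ [])
Aε = A ε
A₀ = A (false ∷ [])
A₁ = A (true ∷ [])

copy : Kind → Addr → Word
copy k α = gen k (false ∷ false ∷ α) ⊙ gen k (true ∷ false ∷ α)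

extend-copy : ∀ a → (extend copy a ∷ []) ≋ (sh0 (sh0 a) ∷ sh1 (sh0 a) ∷ [])
extend-copy []      = ≋-reflexive refl
extend-copy (l ∷ a) = begin
  extend copy (l ∷ a) ∷ []
    ≈⟨ ≋-reflexive refl ⟩
  image copy l ∷ extend copy a ∷ []
    ≈⟨ at 1 (extend-copy a) ⟩
  image copy l ∷ sh0 (sh0 a) ∷ sh1 (sh0 a) ∷ []
    ≈⟨ at 0 (image-copy l) ⟩
  sh0 (sh0 [l]) ∷ sh1 (sh0 [l]) ∷ sh0 (sh0 a) ∷ sh1 (sh0 a) ∷ []
    ≈⟨ at 1 (≋-sym (sh0-sh1-comm (sh0 a) (sh0 [l]))) ⟩
  sh0 (sh0 [l]) ∷ sh0 (sh0 a) ∷ sh1 (sh0 [l]) ∷ sh1 (sh0 a) ∷ []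
    ≈⟨ ≋-reflexive refl ⟩
  sh0 (sh0 (l ∷ a)) ∷ sh1 (sh0 (l ∷ a)) ∷ []
    ∎
  where
  [l] : Word
  [l] = l ∷ []
  image-copy : ∀ l → (image copy l ∷ []) ≋ (sh0 (sh0 (l ∷ [])) ∷ sh1 (sh0 (l ∷ [])) ∷ [])
  image-copy (lt k α true)  = ≋-reflexive refl
  image-copy (lt k α false) = ≋-trans (≋-reflexive refl) (≋-sym (sh0-sh1-comm (sh0 l⁻¹) (sh0 l⁻¹)))
    where
    l⁻¹ : Word
    l⁻¹ = lt k α false ∷ []

sh0-Σε : ∀ a → (sh0 a ∷ Σε ∷ []) ≋ (Σε ∷ sh0 (sh0 a) ∷ sh1 (sh0 a) ∷ [])
sh0-Σε a = ≋-trans (conj-extend (false ∷ []) Σε copy (λ k α → from-≈ (≈-rel (r2 k ε α))) a)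
                   (at 1 (extend-copy a))

sh10-Σε : ∀ b → (sh1 (sh0 b) ∷ Σε ∷ []) ≋ (Σε ∷ sh0 (sh1 b) ∷ [])
sh10-Σε b rewrite sh-sh (true ∷ []) (false ∷ []) b | sh-sh (false ∷ []) (true ∷ []) b =
  conj-sh (true ∷ false ∷ []) (false ∷ true ∷ []) Σε (λ k α → from-≈ (≈-rel (r3 k ε α))) b

sh11-Σε : ∀ w → (sh1 (sh1 w) ∷ Σε ∷ []) ≋ (Σε ∷ sh1 (sh1 w) ∷ [])
sh11-Σε w rewrite sh-sh (true ∷ []) (true ∷ []) w =
  conj-sh (true ∷ true ∷ []) (true ∷ true ∷ []) Σε (λ k α → from-≈ (≈-rel (r4 k ε α))) w

sh0-Aε : ∀ a → (sh0 a ∷ Aε ∷ []) ≋ (Aε ∷ sh0 (sh0 a) ∷ [])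
sh0-Aε a rewrite sh-sh (false ∷ []) (false ∷ []) a =
  conj-sh (false ∷ []) (false ∷ false ∷ []) Aε (λ k α → from-≈ (≈-rel (r5 k ε α))) a

sh10-Aε : ∀ b → (sh1 (sh0 b) ∷ Aε ∷ []) ≋ (Aε ∷ sh0 (sh1 b) ∷ [])
sh10-Aε b rewrite sh-sh (true ∷ []) (false ∷ []) b | sh-sh (false ∷ []) (true ∷ []) b =
  conj-sh (true ∷ false ∷ []) (false ∷ true ∷ []) Aε (λ k α → from-≈ (≈-rel (r6 k ε α))) b

sh11-Aε : ∀ w → (sh1 (sh1 w) ∷ Aε ∷ []) ≋ (Aε ∷ sh1 w ∷ [])
sh11-Aε w rewrite sh-sh (true ∷ []) (true ∷ []) w =
  conj-sh (true ∷ true ∷ []) (true ∷ []) Aε (λ k α → from-≈ (≈-rel (r7 k ε α))) w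

rel₈ : (Σε ∷ Σ₁ ∷ Σε ∷ []) ≋ (Σ₁ ∷ Σε ∷ Σ₁ ∷ Σ₀ ∷ [])
rel₈ = from-≈ (≈-rel (r8 ε))

rel₉ : (Σε ∷ Σ₁ ∷ Aε ∷ []) ≋ (A₁ ∷ Σε ∷ Σ₀ ∷ [])
rel₉ = from-≈ (≈-rel (r9 ε))

rel₁₀ : (Aε ∷ Σε ∷ []) ≋ (Σ₁ ∷ Σε ∷ A₁ ∷ A₀ ∷ [])
rel₁₀ = from-≈ (≈-rel (r10 ε))

~-intro : ∀ {u v} t → v ≈ u ⊙ sh0 t → u ~ v
~-intro {u} {v} t v≈ut = t , to-≈ (begin
  inv u ∷ v ∷ []            ≈⟨ at 1 (≈⇒≋ v≈ut) ⟩
  inv u ∷ u ⊙ sh0 t ∷ []    ≈⟨ ≋-reflexive refl ⟩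
  inv u ∷ u ∷ sh0 t ∷ []    ≈⟨ at 0 (cancelˡ u) ⟩
  sh0 t ∷ []                ∎)

~-elim : ∀ {u v} → (u~v : u ~ v) → v ≈ u ⊙ sh0 (proj₁ u~v)
~-elim {u} {v} (t , u⁻¹v≈t) = to-≈ (begin
  v ∷ []               ≈⟨ ≋-sym (at 0 (cancelʳ u)) ⟩
  u ∷ inv u ∷ v ∷ []   ≈⟨ ≋-reflexive refl ⟩
  u ∷ inv u ⊙ v ∷ []   ≈⟨ at 1 (≈⇒≋ u⁻¹v≈t) ⟩
  u ∷ sh0 t ∷ []       ∎)

~-respʳ-≈ : ∀ {u v v'} → u ~ v → v ≈ v' → u ~ v'
~-respʳ-≈ {u} (t , u⁻¹v≈t) v≈v' = t , ≈-trans (≈-cong (≈-refl {inv u}) (≈-sym v≈v')) u⁻¹v≈t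

~-cong₂ : ∀ (_∙_ : Word → Word → Word) →
          (∀ {g g' h h'} → g ≈ g' → h ≈ h' → g ∙ h ≈ g' ∙ h') →
          (∀ g h a b → (g ⊙ sh0 a) ∙ (h ⊙ sh0 b) ≈ (g ∙ h) ⊙ sh0 (sh0 a ⊙ sh1 b)) →
          ∀ g g' h h' → g ~ g' → h ~ h' → (g ∙ h) ~ (g' ∙ h')
~-cong₂ _∙_ ∙-cong ∙-sh0 g g' h h' (a , p) (b , q) =
  ~-respʳ-≈ {g ∙ h} (~-intro (sh0 a ⊙ sh1 b) (∙-sh0 g h a b))
            (≈-sym (∙-cong (~-elim (a , p)) (~-elim (b , q))))

✶-cong : ∀ {g g' h h'} → g ≈ g' → h ≈ h' → g ✶ h ≈ g' ✶ h'
✶-cong g≈g' h≈h' = ≈-cong g≈g' (≈-cong (sh-cong _ h≈h') (≈-cong ≈-refl (inv-cong (sh-cong _ g≈g'))))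

⊚-cong : ∀ {g g' h h'} → g ≈ g' → h ≈ h' → g ⊚ h ≈ g' ⊚ h'
⊚-cong g≈g' h≈h' = ≈-cong g≈g' (≈-cong (sh-cong _ h≈h') ≈-refl)

✶-sh0 : ∀ g h a b → (g ⊙ sh0 a) ✶ (h ⊙ sh0 b) ≈ (g ✶ h) ⊙ sh0 (sh0 a ⊙ sh1 b)
✶-sh0 g h a b = to-≈ (begin
  g ⊙ sh0 a ∷ sh1 (h ⊙ sh0 b) ∷ Σε ∷ inv (sh1 (g ⊙ sh0 a)) ∷ []
    ≈⟨ at 0 (flatten (g ∷ sh0 a ∷ [])) ⟩
  g ∷ sh0 a ∷ sh1 (h ⊙ sh0 b) ∷ Σε ∷ inv (sh1 (g ⊙ sh0 a)) ∷ []
    ≈⟨ at 2 (sh-∏ _ (h ∷ sh0 b ∷ [])) ⟩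
  g ∷ sh0 a ∷ h₁ ∷ b₁₀ ∷ Σε ∷ inv (sh1 (g ⊙ sh0 a)) ∷ []
    ≈⟨ at 5 (≋-inv (sh-∏ _ (g ∷ sh0 a ∷ []))) ⟩
  g ∷ sh0 a ∷ h₁ ∷ b₁₀ ∷ Σε ∷ inv a₁₀ ∷ inv g₁ ∷ []
    ≈⟨ at 1 (sh0-sh1-comm a h) ⟩
  g ∷ h₁ ∷ sh0 a ∷ b₁₀ ∷ Σε ∷ inv a₁₀ ∷ inv g₁ ∷ []
    ≈⟨ at 3 (sh10-Σε b) ⟩
  g ∷ h₁ ∷ sh0 a ∷ Σε ∷ b₀₁ ∷ inv a₁₀ ∷ inv g₁ ∷ []
    ≈⟨ at 2 (sh0-Σε a) ⟩
  g ∷ h₁ ∷ Σε ∷ a₀₀ ∷ a₁₀ ∷ b₀₁ ∷ inv a₁₀ ∷ inv g₁ ∷ []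
    ≈⟨ at 4 (≋-sym (sh0-sh1-comm (sh1 b) (sh0 a))) ⟩
  g ∷ h₁ ∷ Σε ∷ a₀₀ ∷ b₀₁ ∷ a₁₀ ∷ inv a₁₀ ∷ inv g₁ ∷ []
    ≈⟨ at 5 (cancelʳ a₁₀) ⟩
  g ∷ h₁ ∷ Σε ∷ a₀₀ ∷ b₀₁ ∷ inv g₁ ∷ []
    ≈⟨ at 3 (≋-sym (sh-∏ _ (sh0 a ∷ sh1 b ∷ []))) ⟩
  g ∷ h₁ ∷ Σε ∷ sh0 (sh0 a ⊙ sh1 b) ∷ inv g₁ ∷ []
    ≈⟨ at 3 (sh0-inv-sh1-comm (sh0 a ⊙ sh1 b) (g ∷ [])) ⟩
  g ∷ h₁ ∷ Σε ∷ inv g₁ ∷ sh0 (sh0 a ⊙ sh1 b) ∷ []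
    ≈⟨ at 0 (≋-sym (flatten (g ∷ h₁ ∷ Σε ∷ inv g₁ ∷ []))) ⟩
  g ✶ h ∷ sh0 (sh0 a ⊙ sh1 b) ∷ []
    ∎)
  where
  g₁ h₁ a₀₀ a₁₀ b₀₁ b₁₀ : Word
  g₁  = sh1 g
  h₁  = sh1 h
  a₀₀ = sh0 (sh0 a)
  a₁₀ = sh1 (sh0 a)
  b₀₁ = sh0 (sh1 b)
  b₁₀ = sh1 (sh0 b)

⊚-sh0 : ∀ g h a b → (g ⊙ sh0 a) ⊚ (h ⊙ sh0 b) ≈ (g ⊚ h) ⊙ sh0 (sh0 a ⊙ sh1 b)
⊚-sh0 g h a b = to-≈ (begin
  g ⊙ sh0 a ∷ sh1 (h ⊙ sh0 b) ∷ Aε ∷ []            ≈⟨ at 0 (flatten (g ∷ sh0 a ∷ [])) ⟩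
  g ∷ sh0 a ∷ sh1 (h ⊙ sh0 b) ∷ Aε ∷ []            ≈⟨ at 2 (sh-∏ _ (h ∷ sh0 b ∷ [])) ⟩
  g ∷ sh0 a ∷ sh1 h ∷ sh1 (sh0 b) ∷ Aε ∷ []        ≈⟨ at 1 (sh0-sh1-comm a h) ⟩
  g ∷ sh1 h ∷ sh0 a ∷ sh1 (sh0 b) ∷ Aε ∷ []        ≈⟨ at 3 (sh10-Aε b) ⟩
  g ∷ sh1 h ∷ sh0 a ∷ Aε ∷ sh0 (sh1 b) ∷ []        ≈⟨ at 2 (sh0-Aε a) ⟩
  g ∷ sh1 h ∷ Aε ∷ sh0 (sh0 a) ∷ sh0 (sh1 b) ∷ []  ≈⟨ at 3 (≋-sym (sh-∏ _ (sh0 a ∷ sh1 b ∷ []))) ⟩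
  g ∷ sh1 h ∷ Aε ∷ sh0 (sh0 a ⊙ sh1 b) ∷ []        ≈⟨ at 0 (≋-sym (flatten (g ∷ sh1 h ∷ Aε ∷ []))) ⟩
  g ⊚ h ∷ sh0 (sh0 a ⊙ sh1 b) ∷ []                 ∎)

sh1-✶ : ∀ g h → (sh1 (g ✶ h) ∷ []) ≋ (sh1 g ∷ sh1 (sh1 h) ∷ Σ₁ ∷ inv (sh1 (sh1 g)) ∷ [])
sh1-✶ g h = ≋-trans (sh-∏ _ (g ∷ sh1 h ∷ Σε ∷ inv (sh1 g) ∷ [])) (at 3 (≡⇒≋ (sh-inv _ (sh1 g))))

expand-✶✶ : ∀ x y z →
  (x ✶ (y ✶ z) ∷ []) ≋ (x ∷ sh1 y ∷ sh1 (sh1 z) ∷ Σ₁ ∷ inv (sh1 (sh1 y)) ∷ Σε ∷ inv (sh1 x) ∷ [])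
expand-✶✶ x y z = ≋-trans (flatten (x ∷ sh1 (y ✶ z) ∷ Σε ∷ inv (sh1 x) ∷ [])) (at 1 (sh1-✶ y z))

expand-✶⊙sh1✶ : ∀ x y z →
  ((x ✶ y) ∷ sh1 (x ✶ z) ∷ []) ≋ (x ∷ sh1 y ∷ sh1 (sh1 z) ∷ Σε ∷ Σ₁ ∷ inv (sh1 (sh1 x)) ∷ [])
expand-✶⊙sh1✶ x y z = begin
  x ✶ y ∷ sh1 (x ✶ z) ∷ []                        ≈⟨ at 0 (flatten (x ∷ y₁ ∷ Σε ∷ inv x₁ ∷ [])) ⟩
  x ∷ y₁ ∷ Σε ∷ inv x₁ ∷ sh1 (x ✶ z) ∷ []         ≈⟨ at 4 (sh1-✶ x z) ⟩
  x ∷ y₁ ∷ Σε ∷ inv x₁ ∷ x₁ ∷ z₁₁ ∷ Σ₁ ∷ inv x₁₁ ∷ []  ≈⟨ at 3 (cancelˡ x₁) ⟩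
  x ∷ y₁ ∷ Σε ∷ z₁₁ ∷ Σ₁ ∷ inv x₁₁ ∷ []            ≈⟨ at 2 (≋-sym (sh11-Σε z)) ⟩
  x ∷ y₁ ∷ z₁₁ ∷ Σε ∷ Σ₁ ∷ inv x₁₁ ∷ []            ∎
  where
  x₁ y₁ x₁₁ z₁₁ : Word
  x₁  = sh1 x
  y₁  = sh1 y
  x₁₁ = sh1 (sh1 x)
  z₁₁ = sh1 (sh1 z)

✶-distribˡ-✶ : ∀ x y z → (x ✶ y) ✶ (x ✶ z) ≈ (x ✶ (y ✶ z)) ⊙ sh0 Σε
✶-distribˡ-✶ x y z = to-≈ (begin
  x ✶ y ∷ sh1 (x ✶ z) ∷ Σε ∷ inv (sh1 (x ✶ y)) ∷ []
    ≈⟨ at 0 (expand-✶⊙sh1✶ x y z) ⟩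
  x ∷ y₁ ∷ z₁₁ ∷ Σε ∷ Σ₁ ∷ inv x₁₁ ∷ Σε ∷ inv (sh1 (x ✶ y)) ∷ []
    ≈⟨ at 7 (≋-inv (sh1-✶ x y)) ⟩
  x ∷ y₁ ∷ z₁₁ ∷ Σε ∷ Σ₁ ∷ inv x₁₁ ∷ Σε ∷ inv (inv x₁₁) ∷ inv Σ₁ ∷ inv y₁₁ ∷ inv x₁ ∷ []
    ≈⟨ at 5 (conj-inv (sh11-Σε x)) ⟩
  x ∷ y₁ ∷ z₁₁ ∷ Σε ∷ Σ₁ ∷ Σε ∷ inv x₁₁ ∷ inv (inv x₁₁) ∷ inv Σ₁ ∷ inv y₁₁ ∷ inv x₁ ∷ []
    ≈⟨ at 6 (cancelʳ (inv x₁₁)) ⟩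
  x ∷ y₁ ∷ z₁₁ ∷ Σε ∷ Σ₁ ∷ Σε ∷ inv Σ₁ ∷ inv y₁₁ ∷ inv x₁ ∷ []
    ≈⟨ at 3 rel₈ ⟩
  x ∷ y₁ ∷ z₁₁ ∷ Σ₁ ∷ Σε ∷ Σ₁ ∷ Σ₀ ∷ inv Σ₁ ∷ inv y₁₁ ∷ inv x₁ ∷ []
    ≈⟨ at 6 (sh0-inv-sh1-comm Σε (Σε ∷ sh1 y ∷ x ∷ [])) ⟩
  x ∷ y₁ ∷ z₁₁ ∷ Σ₁ ∷ Σε ∷ Σ₁ ∷ inv Σ₁ ∷ inv y₁₁ ∷ inv x₁ ∷ Σ₀ ∷ []
    ≈⟨ at 5 (cancelʳ Σ₁) ⟩
  x ∷ y₁ ∷ z₁₁ ∷ Σ₁ ∷ Σε ∷ inv y₁₁ ∷ inv x₁ ∷ Σ₀ ∷ []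
    ≈⟨ at 4 (≋-sym (conj-inv (sh11-Σε y))) ⟩
  x ∷ y₁ ∷ z₁₁ ∷ Σ₁ ∷ inv y₁₁ ∷ Σε ∷ inv x₁ ∷ Σ₀ ∷ []
    ≈⟨ at 0 (≋-sym (expand-✶✶ x y z)) ⟩
  x ✶ (y ✶ z) ∷ Σ₀ ∷ []
    ∎)
  where
  x₁ y₁ x₁₁ y₁₁ z₁₁ : Word
  x₁  = sh1 x
  y₁  = sh1 y
  x₁₁ = sh1 (sh1 x)
  y₁₁ = sh1 (sh1 y)
  z₁₁ = sh1 (sh1 z)

✶-distribˡ-⊚ : ∀ x y z → (x ✶ y) ⊚ (x ✶ z) ≈ (x ✶ (y ⊚ z)) ⊙ sh0 Σε
✶-distribˡ-⊚ x y z = to-≈ (begin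
  x ✶ y ∷ sh1 (x ✶ z) ∷ Aε ∷ []
    ≈⟨ at 0 (expand-✶⊙sh1✶ x y z) ⟩
  x ∷ y₁ ∷ z₁₁ ∷ Σε ∷ Σ₁ ∷ inv x₁₁ ∷ Aε ∷ []
    ≈⟨ at 5 (conj-inv (sh11-Aε x)) ⟩
  x ∷ y₁ ∷ z₁₁ ∷ Σε ∷ Σ₁ ∷ Aε ∷ inv x₁ ∷ []
    ≈⟨ at 3 rel₉ ⟩
  x ∷ y₁ ∷ z₁₁ ∷ A₁ ∷ Σε ∷ Σ₀ ∷ inv x₁ ∷ []
    ≈⟨ at 5 (sh0-inv-sh1-comm Σε (x ∷ [])) ⟩
  x ∷ y₁ ∷ z₁₁ ∷ A₁ ∷ Σε ∷ inv x₁ ∷ Σ₀ ∷ []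
    ≈⟨ at 1 (≋-sym (sh-∏ _ (y ∷ sh1 z ∷ Aε ∷ []))) ⟩
  x ∷ sh1 (y ⊚ z) ∷ Σε ∷ inv x₁ ∷ Σ₀ ∷ []
    ≈⟨ at 0 (≋-sym (flatten (x ∷ sh1 (y ⊚ z) ∷ Σε ∷ inv x₁ ∷ []))) ⟩
  x ✶ (y ⊚ z) ∷ Σ₀ ∷ []
    ∎)
  where
  x₁ y₁ x₁₁ z₁₁ : Word
  x₁  = sh1 x
  y₁  = sh1 y
  x₁₁ = sh1 (sh1 x)
  z₁₁ = sh1 (sh1 z)

⊚-✶ : ∀ x y z → (x ⊚ y) ✶ z ≈ (x ✶ (y ✶ z)) ⊙ sh0 Aε
⊚-✶ x y z = to-≈ (begin
  x ⊚ y ∷ sh1 z ∷ Σε ∷ inv (sh1 (x ⊚ y)) ∷ []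
    ≈⟨ at 0 (flatten (x ∷ y₁ ∷ Aε ∷ [])) ⟩
  x ∷ y₁ ∷ Aε ∷ sh1 z ∷ Σε ∷ inv (sh1 (x ⊚ y)) ∷ []
    ≈⟨ at 5 (≋-inv (sh-∏ _ (x ∷ sh1 y ∷ Aε ∷ []))) ⟩
  x ∷ y₁ ∷ Aε ∷ sh1 z ∷ Σε ∷ inv A₁ ∷ inv y₁₁ ∷ inv x₁ ∷ []
    ≈⟨ at 2 (≋-sym (sh11-Aε z)) ⟩
  x ∷ y₁ ∷ z₁₁ ∷ Aε ∷ Σε ∷ inv A₁ ∷ inv y₁₁ ∷ inv x₁ ∷ []
    ≈⟨ at 3 rel₁₀ ⟩
  x ∷ y₁ ∷ z₁₁ ∷ Σ₁ ∷ Σε ∷ A₁ ∷ A₀ ∷ inv A₁ ∷ inv y₁₁ ∷ inv x₁ ∷ []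
    ≈⟨ at 6 (sh0-inv-sh1-comm Aε (Aε ∷ sh1 y ∷ x ∷ [])) ⟩
  x ∷ y₁ ∷ z₁₁ ∷ Σ₁ ∷ Σε ∷ A₁ ∷ inv A₁ ∷ inv y₁₁ ∷ inv x₁ ∷ A₀ ∷ []
    ≈⟨ at 5 (cancelʳ A₁) ⟩
  x ∷ y₁ ∷ z₁₁ ∷ Σ₁ ∷ Σε ∷ inv y₁₁ ∷ inv x₁ ∷ A₀ ∷ []
    ≈⟨ at 4 (≋-sym (conj-inv (sh11-Σε y))) ⟩
  x ∷ y₁ ∷ z₁₁ ∷ Σ₁ ∷ inv y₁₁ ∷ Σε ∷ inv x₁ ∷ A₀ ∷ []
    ≈⟨ at 0 (≋-sym (expand-✶✶ x y z)) ⟩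
  x ✶ (y ✶ z) ∷ A₀ ∷ []
    ∎)
  where
  x₁ y₁ y₁₁ z₁₁ : Word
  x₁  = sh1 x
  y₁  = sh1 y
  y₁₁ = sh1 (sh1 y)
  z₁₁ = sh1 (sh1 z)

proposition4p4 :
    ((g g' h h' : Word) → g ~ g' → h ~ h' → ((g ✶ h) ~ (g' ✶ h') × (g ⊚ h) ~ (g' ⊚ h')))
    × ((x y z : Word) →
         (x ✶ (y ✶ z)) ~ ((x ✶ y) ✶ (x ✶ z))
         × (x ✶ (y ⊚ z)) ~ ((x ✶ y) ⊚ (x ✶ z))
         × (x ✶ (y ✶ z)) ~ ((x ⊚ y) ✶ z))
proposition4p4 = well-defined , laws
  where
  well-defined : (g g' h h' : Word) → g ~ g' → h ~ h' → (g ✶ h) ~ (g' ✶ h') × (g ⊚ h) ~ (g' ⊚ h')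
  well-defined g g' h h' g~g' h~h' =
    ~-cong₂ _✶_ ✶-cong ✶-sh0 g g' h h' g~g' h~h' , ~-cong₂ _⊚_ ⊚-cong ⊚-sh0 g g' h h' g~g' h~h'

  laws : (x y z : Word) → (x ✶ (y ✶ z)) ~ ((x ✶ y) ✶ (x ✶ z))
                        × (x ✶ (y ⊚ z)) ~ ((x ✶ y) ⊚ (x ✶ z))
                        × (x ✶ (y ✶ z)) ~ ((x ⊚ y) ✶ z)
  laws x y z =
    ~-intro Σε (✶-distribˡ-✶ x y z) , ~-intro Σε (✶-distribˡ-⊚ x y z) , ~-intro Aε (⊚-✶ x y z)
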